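{- Let $\mathbf T_{\le0}$ be the set of CoR terms containing no occurrence of any variable. Then $\mathbf T_{\le0}/{\sim_{\mathrm{REL}_{\ge3}}}=\{[\bot],[\top],[\mathrm{I}],[\mathrm{D}]\}$, where $[t]$ denotes the $\sim_{\mathrm{REL}_{\ge3}}$-class of $t$; that is, every variable-free CoR term is $\sim_{\mathrm{REL}_{\ge3}}$-equivalent to one of $\bot,\top,\mathrm{I},\mathrm{D}$.
   Context: Fix a non-empty finite set $V$ of variables. CoR terms are generated by $t ::= a \mid \bot \mid \top \mid t\cup t \mid t\cap t \mid t^{ - } \mid \mathrm{I} \mid \mathrm{D} \mid t\cdot t \mid t\dagger t \mid t^{\pi}$ ($a\in V$, $\pi:\{1,2\}\to\{1,2\}$). A structure $M$ is a non-empty set $|M|$ with relations $a^M\subseteq|M|^2$ for $a\in V$; $[\![t]\!]_M\subseteq|M|^2$ interprets $\bot,\top$ as $\emptyset,|M|^2$, $\cup,\cap,{}^-$ set-theoretically (complement w.r.t. $|M|^2$), $\mathrm{I}$ as identity, $\mathrm{D}$ as $\{(x,y):x\ne y\}$, $R\cdot S=\{(x,y):\exists z,(x,z)\in R\wedge(z,y)\in S\}$, $R\dagger S=\{(x,y):\forall z,(x,z)\in R\vee(z,y)\in S\}$, $R^\pi=\{(x_1,x_2):(x_{\pi(1)},x_{\pi(2)})\in R\}$. $\mathrm{REL}_{\ge 3}$ is the class of structures with at least 3 elements, and $t\sim_{\mathrm{REL}_{\ge3}}s$ iff $[\![t]\!]_M=[\![s]\!]_M$ for all such $M$. -}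

module Defs where

open import Data.Nat using (ℕ; suc)
open import Data.Fin using (Fin; zero; suc)
open import Data.Product using (Σ; _×_; _,_)
open import Data.Sum using (_⊎_)
open import Data.Empty using (⊥)
open import Data.Unit using (⊤)
open import Relation.Nullary using (¬_; Dec)
open import Relation.Binary.PropositionalEquality using (_≡_)
open import Function.Bundles using (_⇔_)

-- A map π : {1,2} → {1,2}; {1,2} is represented by Fin 2 (zero ↦ 1, suc zero ↦ 2).
Perm : Set
Perm = Fin 2 → Fin 2

data Term (n : ℕ) : Set where
  var  : Fin n → Term n
  bot  : Term n
  top  : Term n
  _∪_  : Term n → Term n → Term n
  _∩_  : Term n → Term n → Term n
  ⁻_   : Term n → Term n
  I    : Term n
  D    : Term n
  _·_  : Term n → Term n → Term n
  _†_  : Term n → Term n → Term n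
  _^_  : Term n → Perm → Term n

-- A structure: non-empty carrier with a binary relation for each variable.
record Structure (n : ℕ) : Set₁ where
  field
    Carrier : Set
    elem    : Carrier
    rel     : Fin n → Carrier → Carrier → Set

open Structure public

AtLeast3 : ∀ {n} → Structure n → Set
AtLeast3 M = Σ (Carrier M) λ x → Σ (Carrier M) λ y → Σ (Carrier M) λ z →
  ¬ x ≡ y × ¬ x ≡ z × ¬ y ≡ z

pick : ∀ {A : Set} → A → A → Fin 2 → A
pick x₁ x₂ zero    = x₁
pick x₁ x₂ (suc _) = x₂

⟦_⟧ : ∀ {n} → Term n → (M : Structure n) → Carrier M → Carrier M → Set
⟦ var a ⟧ M x y = rel M a x y
⟦ bot ⟧   M x y = ⊥
⟦ top ⟧   M x y = ⊤
⟦ t ∪ s ⟧ M x y = ⟦ t ⟧ M x y ⊎ ⟦ s ⟧ M x y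
⟦ t ∩ s ⟧ M x y = ⟦ t ⟧ M x y × ⟦ s ⟧ M x y
⟦ ⁻ t ⟧   M x y = ¬ ⟦ t ⟧ M x y
⟦ I ⟧     M x y = x ≡ y
⟦ D ⟧     M x y = ¬ x ≡ y
⟦ t · s ⟧ M x y = Σ (Carrier M) λ z → ⟦ t ⟧ M x z × ⟦ s ⟧ M z y
⟦ t † s ⟧ M x y = ∀ z → ⟦ t ⟧ M x z ⊎ ⟦ s ⟧ M z y
⟦ t ^ π ⟧ M x y = ⟦ t ⟧ M (pick x y (π zero)) (pick x y (π (suc zero)))

_∼REL≥3_ : ∀ {n} → Term n → Term n → Set₁
t ∼REL≥3 s = ∀ (M : Structure _) → AtLeast3 M →
  ∀ x y → ⟦ t ⟧ M x y ⇔ ⟦ s ⟧ M x y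

data VarFree {n : ℕ} : Term n → Set where
  bot : VarFree bot
  top : VarFree top
  I   : VarFree I
  D   : VarFree D
  _∪_ : ∀ {t s} → VarFree t → VarFree s → VarFree (t ∪ s)
  _∩_ : ∀ {t s} → VarFree t → VarFree s → VarFree (t ∩ s)
  ⁻_  : ∀ {t} → VarFree t → VarFree (⁻ t)
  _·_ : ∀ {t s} → VarFree t → VarFree s → VarFree (t · s)
  _†_ : ∀ {t s} → VarFree t → VarFree s → VarFree (t † s)
  _^_ : ∀ {t} → VarFree t → (π : Perm) → VarFree (t ^ π)

-- Classical logic (the paper's metatheory is classical set theory).
ExcludedMiddle : Set₁
ExcludedMiddle = ∀ (P : Set) → Dec P

{-# OPTIONS --safe #-}
-- On a structure with at least three elements the meaning of a variable-free
-- term depends only on whether its two arguments are equal, so it is fixed by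
-- two truth values, on and off the diagonal; the four combinations are ⊥, ⊤, I
-- and D. Boolean operations and converses act on these values pointwise. For a
-- composite the middle point is x, y or a third point, and a third point
-- distinct from any two given ones always exists. Finally t † s is
-- classically the complement of (⁻ t) · (⁻ s).
module Submission where

open import Defs
open import Data.Bool using (Bool; true; false; T; _∧_; _∨_; not)
open import Data.Bool.Properties using (T-∧; T-∨)
open import Data.Empty using (⊥-elim)
open import Data.Fin using (Fin; zero; suc)
open import Data.Nat using (ℕ; suc)
open import Data.Product using (Σ; _×_; _,_)
open import Data.Product.Function.NonDependent.Propositional using (_×-⇔_)
open import Data.Sum using (_⊎_; inj₁; inj₂; [_,_])
open import Data.Sum.Function.Propositional using (_⊎-⇔_)
open import Data.Unit using (tt)
open import Function.Base using (_∘_)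
open import Function.Bundles using (_⇔_; mk⇔; Equivalence)
open import Function.Properties.Equivalence using ()
  renaming (refl to ⇔-refl; sym to ⇔-sym; trans to ⇔-trans)
open import Function.Related.TypeIsomorphisms using (¬-cong-⇔)
open import Relation.Binary.PropositionalEquality using (_≡_; _≢_; refl; sym)
open import Relation.Nullary using (¬_; yes; no)

open Equivalence

⊎-reflects-∨ : ∀ {A B : Set} {a b} → A ⇔ T a → B ⇔ T b → (A ⊎ B) ⇔ T (a ∨ b)
⊎-reflects-∨ A⇔a B⇔b = ⇔-trans (A⇔a ⊎-⇔ B⇔b) (⇔-sym T-∨)

×-reflects-∧ : ∀ {A B : Set} {a b} → A ⇔ T a → B ⇔ T b → (A × B) ⇔ T (a ∧ b)
×-reflects-∧ A⇔a B⇔b = ⇔-trans (A⇔a ×-⇔ B⇔b) (⇔-sym T-∧)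

¬T⇔T-not : ∀ {a} → (¬ T a) ⇔ T (not a)
¬T⇔T-not {true}  = mk⇔ (λ ¬t → ¬t tt) ⊥-elim
¬T⇔T-not {false} = mk⇔ (λ _ → tt) (λ _ ())

¬-reflects-not : ∀ {A : Set} {a} → A ⇔ T a → (¬ A) ⇔ T (not a)
¬-reflects-not A⇔a = ⇔-trans (¬-cong-⇔ A⇔a) ¬T⇔T-not

record HasProfile {A : Set} (R : A → A → Set) (d o : Bool) : Set where
  field
    diagonal    : ∀ x → R x x ⇔ T d
    offDiagonal : ∀ {x y} → x ≢ y → R x y ⇔ T o

open HasProfile

module _ {A : Set} {R S : A → A → Set} {d₁ o₁ d₂ o₂ : Bool}
         (R-profile : HasProfile R d₁ o₁) (S-profile : HasProfile S d₂ o₂) where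

  ∪-profile : HasProfile (λ x y → R x y ⊎ S x y) (d₁ ∨ d₂) (o₁ ∨ o₂)
  ∪-profile = record
    { diagonal    = λ x → ⊎-reflects-∨ (diagonal R-profile x) (diagonal S-profile x)
    ; offDiagonal = λ x≢y → ⊎-reflects-∨ (offDiagonal R-profile x≢y) (offDiagonal S-profile x≢y)
    }

  ∩-profile : HasProfile (λ x y → R x y × S x y) (d₁ ∧ d₂) (o₁ ∧ o₂)
  ∩-profile = record
    { diagonal    = λ x → ×-reflects-∧ (diagonal R-profile x) (diagonal S-profile x)
    ; offDiagonal = λ x≢y → ×-reflects-∧ (offDiagonal R-profile x≢y) (offDiagonal S-profile x≢y)
    }

∁ : ∀ {A : Set} → (A → A → Set) → A → A → Set
∁ R x y = ¬ R x y

∁-profile : ∀ {A : Set} {R : A → A → Set} {d o} →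
            HasProfile R d o → HasProfile (∁ R) (not d) (not o)
∁-profile R-profile = record
  { diagonal    = λ x → ¬-reflects-not (diagonal R-profile x)
  ; offDiagonal = λ x≢y → ¬-reflects-not (offDiagonal R-profile x≢y)
  }

profile-resp-⇔ : ∀ {A : Set} {R S : A → A → Set} {d o} →
                 (∀ x y → S x y ⇔ R x y) → HasProfile R d o → HasProfile S d o
profile-resp-⇔ S⇔R R-profile = record
  { diagonal    = λ x → ⇔-trans (S⇔R x x) (diagonal R-profile x)
  ; offDiagonal = λ {x} {y} x≢y → ⇔-trans (S⇔R x y) (offDiagonal R-profile x≢y)
  }

offDiagonalAfterPick : Fin 2 → Fin 2 → Bool → Bool → Bool
offDiagonalAfterPick zero    zero    d o = d
offDiagonalAfterPick zero    (suc _) d o = o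
offDiagonalAfterPick (suc _) zero    d o = o
offDiagonalAfterPick (suc _) (suc _) d o = d

pick-profile : ∀ {A : Set} {R : A → A → Set} {d o} → HasProfile R d o → ∀ i j →
               HasProfile (λ x y → R (pick x y i) (pick x y j)) d (offDiagonalAfterPick i j d o)
pick-profile R-profile zero    zero    = record
  { diagonal = diagonal R-profile ; offDiagonal = λ {x} _ → diagonal R-profile x }
pick-profile R-profile zero    (suc _) = record
  { diagonal = diagonal R-profile ; offDiagonal = offDiagonal R-profile }
pick-profile R-profile (suc _) zero    = record
  { diagonal = diagonal R-profile ; offDiagonal = λ x≢y → offDiagonal R-profile (x≢y ∘ sym) }
pick-profile R-profile (suc _) (suc _) = record
  { diagonal = diagonal R-profile ; offDiagonal = λ {_} {y} _ → diagonal R-profile y }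

_⨾_ : ∀ {A : Set} → (A → A → Set) → (A → A → Set) → A → A → Set
(R ⨾ S) x y = Σ _ λ z → R x z × S z y

Detour : ∀ {A : Set} → (A → A → Set) → (A → A → Set) → A → A → Set
Detour {A} R S x y = Σ A λ z → (x ≢ z × z ≢ y) × (R x z × S z y)

module _ (em : ExcludedMiddle) where

  freshPoint : ∀ {A : Set} {a b c : A} → a ≢ b → a ≢ c → b ≢ c →
               ∀ x y → Σ A λ z → x ≢ z × z ≢ y
  freshPoint {a = a} {b} {c} a≢b a≢c b≢c x y with em (x ≡ a ⊎ y ≡ a) | em (x ≡ b ⊎ y ≡ b)
  ... | no a-fresh | _ = a , a-fresh ∘ inj₁ , a-fresh ∘ inj₂ ∘ sym
  ... | yes _ | no b-fresh = b , b-fresh ∘ inj₁ , b-fresh ∘ inj₂ ∘ sym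
  ... | yes (inj₁ refl) | yes (inj₁ x≡b) = ⊥-elim (a≢b x≡b)
  ... | yes (inj₂ refl) | yes (inj₂ y≡b) = ⊥-elim (a≢b y≡b)
  ... | yes (inj₁ refl) | yes (inj₂ refl) = c , a≢c , b≢c ∘ sym
  ... | yes (inj₂ refl) | yes (inj₁ refl) = c , b≢c , a≢c ∘ sym

  ⨾-split : ∀ {A : Set} {R S : A → A → Set} x y →
            (R ⨾ S) x y ⇔ ((R x x × S x y) ⊎ (R x y × S y y) ⊎ Detour R S x y)
  ⨾-split {R = R} {S} x y = mk⇔ split join
    where
    split : (R ⨾ S) x y → (R x x × S x y) ⊎ (R x y × S y y) ⊎ Detour R S x y
    split (z , r , s) with em (x ≡ z) | em (z ≡ y)
    ... | yes refl | _        = inj₁ (r , s)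
    ... | no _     | yes refl = inj₂ (inj₁ (r , s))
    ... | no x≢z   | no z≢y   = inj₂ (inj₂ (z , (x≢z , z≢y) , r , s))
    join : (R x x × S x y) ⊎ (R x y × S y y) ⊎ Detour R S x y → (R ⨾ S) x y
    join (inj₁ (r , s))                = x , r , s
    join (inj₂ (inj₁ (r , s)))         = y , r , s
    join (inj₂ (inj₂ (z , _ , r , s))) = z , r , s

  module _ {A : Set} (fresh : ∀ (x y : A) → Σ A λ z → x ≢ z × z ≢ y)
           {R S : A → A → Set} {d₁ o₁ d₂ o₂ : Bool}
           (R-profile : HasProfile R d₁ o₁) (S-profile : HasProfile S d₂ o₂) where

    detour-reflects : ∀ x y → Detour R S x y ⇔ T (o₁ ∧ o₂)
    detour-reflects x y = mk⇔
      (λ { (z , (x≢z , z≢y) , rs) → to (offDiagonal-∧ x≢z z≢y) rs })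
      (λ o₁∧o₂ → let (z , x≢z , z≢y) = fresh x y
                 in z , (x≢z , z≢y) , from (offDiagonal-∧ x≢z z≢y) o₁∧o₂)
      where
      offDiagonal-∧ : ∀ {z} → x ≢ z → z ≢ y → (R x z × S z y) ⇔ T (o₁ ∧ o₂)
      offDiagonal-∧ x≢z z≢y = ×-reflects-∧ (offDiagonal R-profile x≢z) (offDiagonal S-profile z≢y)

    ⨾-profile : HasProfile (R ⨾ S)
                           ((d₁ ∧ d₂) ∨ (d₁ ∧ d₂) ∨ (o₁ ∧ o₂))
                           ((d₁ ∧ o₂) ∨ (o₁ ∧ d₂) ∨ (o₁ ∧ o₂))
    ⨾-profile = record
      { diagonal    = λ x → ⇔-trans (⨾-split {R = R} {S} x x) (⊎-reflects-∨ (diagonal-∧ x)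
                          (⊎-reflects-∨ (diagonal-∧ x) (detour-reflects x x)))
      ; offDiagonal = λ {x} {y} x≢y → ⇔-trans (⨾-split {R = R} {S} x y) (⊎-reflects-∨
                          (×-reflects-∧ (diagonal R-profile x) (offDiagonal S-profile x≢y))
                          (⊎-reflects-∨
                            (×-reflects-∧ (offDiagonal R-profile x≢y) (diagonal S-profile y))
                            (detour-reflects x y)))
      }
      where
      diagonal-∧ : ∀ x → (R x x × S x x) ⇔ T (d₁ ∧ d₂)
      diagonal-∧ x = ×-reflects-∧ (diagonal R-profile x) (diagonal S-profile x)

  †⇔¬⨾¬ : ∀ {A : Set} {R S : A → A → Set} x y →
          (∀ z → R x z ⊎ S z y) ⇔ (¬ (∁ R ⨾ ∁ S) x y)
  †⇔¬⨾¬ {A} {R} {S} x y = mk⇔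
    (λ R†S (z , ¬r , ¬s) → [ ¬r , ¬s ] (R†S z))
    excluded-witness
    where
    excluded-witness : ¬ (∁ R ⨾ ∁ S) x y → ∀ z → R x z ⊎ S z y
    excluded-witness ¬⨾ z with em (R x z) | em (S z y)
    ... | yes r | _     = inj₁ r
    ... | no _  | yes s = inj₂ s
    ... | no ¬r | no ¬s = ⊥-elim (¬⨾ (z , ¬r , ¬s))

  profile-unique : ∀ {A : Set} {R S : A → A → Set} {d o} →
                   HasProfile R d o → HasProfile S d o → ∀ x y → R x y ⇔ S x y
  profile-unique R-profile S-profile x y with em (x ≡ y)
  ... | yes refl = ⇔-trans (diagonal R-profile x) (⇔-sym (diagonal S-profile x))
  ... | no x≢y   = ⇔-trans (offDiagonal R-profile x≢y) (⇔-sym (offDiagonal S-profile x≢y))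

Determined : ∀ {m} → Term m → Bool → Bool → Set₁
Determined t d o = ∀ M → AtLeast3 M → HasProfile (⟦ t ⟧ M) d o

shape : ∀ {m} → Bool → Bool → Term m
shape false false = bot
shape true  true  = top
shape true  false = I
shape false true  = D

shape-determined : ∀ {m} d o → Determined (shape {m} d o) d o
shape-determined false false M _ = record
  { diagonal = λ _ → ⇔-refl ; offDiagonal = λ _ → ⇔-refl }
shape-determined true  true  M _ = record
  { diagonal = λ _ → ⇔-refl ; offDiagonal = λ _ → ⇔-refl }
shape-determined true  false M _ = record
  { diagonal = λ _ → mk⇔ _ (λ _ → refl) ; offDiagonal = λ x≢y → mk⇔ x≢y ⊥-elim }
shape-determined false true  M _ = record
  { diagonal = λ _ → mk⇔ (λ x≢x → x≢x refl) ⊥-elim ; offDiagonal = λ x≢y → mk⇔ _ (λ _ → x≢y) }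

module _ (em : ExcludedMiddle) {m : ℕ} where

  freshIn : ∀ (M : Structure m) → AtLeast3 M → ∀ x y → Σ (Carrier M) λ z → x ≢ z × z ≢ y
  freshIn M (_ , _ , _ , a≢b , a≢c , b≢c) = freshPoint em a≢b a≢c b≢c

  determined : ∀ {t : Term m} → VarFree t → Σ Bool λ d → Σ Bool λ o → Determined t d o
  determined bot = _ , _ , shape-determined false false
  determined top = _ , _ , shape-determined true true
  determined I   = _ , _ , shape-determined true false
  determined D   = _ , _ , shape-determined false true
  determined (vt ∪ vs) with determined vt | determined vs
  ... | _ , _ , t-det | _ , _ , s-det = _ , _ , λ M M≥3 → ∪-profile (t-det M M≥3) (s-det M M≥3)
  determined (vt ∩ vs) with determined vt | determined vs
  ... | _ , _ , t-det | _ , _ , s-det = _ , _ , λ M M≥3 → ∩-profile (t-det M M≥3) (s-det M M≥3)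
  determined (⁻ vt) with determined vt
  ... | _ , _ , t-det = _ , _ , λ M M≥3 → ∁-profile (t-det M M≥3)
  determined (vt · vs) with determined vt | determined vs
  ... | _ , _ , t-det | _ , _ , s-det =
    _ , _ , λ M M≥3 → ⨾-profile em (freshIn M M≥3) (t-det M M≥3) (s-det M M≥3)
  determined (vt † vs) with determined vt | determined vs
  ... | _ , _ , t-det | _ , _ , s-det =
    _ , _ , λ M M≥3 → profile-resp-⇔ (†⇔¬⨾¬ em) (∁-profile
      (⨾-profile em (freshIn M M≥3) (∁-profile (t-det M M≥3)) (∁-profile (s-det M M≥3))))
  determined (vt ^ π) with determined vt
  ... | _ , _ , t-det = _ , _ , λ M M≥3 → pick-profile (t-det M M≥3) (π zero) (π (suc zero))

  ∼-shape : ∀ {t : Term m} {d o} → Determined t d o → t ∼REL≥3 shape d o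
  ∼-shape {d = d} {o} t-det M M≥3 = profile-unique em (t-det M M≥3) (shape-determined d o M M≥3)

lemma4p3 : ExcludedMiddle → (n : ℕ) → (t : Term (suc n)) → VarFree t →
    (t ∼REL≥3 bot) ⊎ (t ∼REL≥3 top) ⊎ (t ∼REL≥3 I) ⊎ (t ∼REL≥3 D)
lemma4p3 em n t vt with determined em vt
... | false , false , t-det = inj₁ (∼-shape em {t = t} t-det)
... | true  , true  , t-det = inj₂ (inj₁ (∼-shape em {t = t} t-det))
... | true  , false , t-det = inj₂ (inj₂ (inj₁ (∼-shape em {t = t} t-det)))
... | false , true  , t-det = inj₂ (inj₂ (inj₂ (∼-shape em {t = t} t-det)))
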